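{- Let $r,n$ be positive integers and let $\epsilon,\epsilon'\in\mathbb{Z}_r^n$ (entries in $\{0,1,\dots,r-1\}$) satisfy $\operatorname{supp}(\epsilon)=\operatorname{supp}(\epsilon')$, where $\operatorname{supp}(\epsilon)=\{i\mid \epsilon_i>0\}$. Then for every $\pi\in\mathfrak{S}_n$, \[\operatorname{Des}(\epsilon',\pi)=\operatorname{Des}(\epsilon,\pi),\] and consequently $\operatorname{des}(\epsilon',\pi)=\operatorname{des}(\epsilon,\pi)$ and $\operatorname{maj}(\epsilon',\pi)=\operatorname{maj}(\epsilon,\pi)$. Moreover, \[\sum_{(v,k)\in L_\epsilon} m(v,k)=\Big(\sum_{(v',k)\in L_{\epsilon'}} m(v',k)\Big)\,u^{\operatorname{col}(\epsilon)-\operatorname{col}(\epsilon')}.\]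
   Context: The wreath product $\mathbb{Z}_r\wr\mathfrak{S}_n$ is the set of pairs $(\epsilon,\pi)$ with $\epsilon\in[0,r-1]^n$ and $\pi\in\mathfrak{S}_n$, written in window notation $[\pi(1)^{\epsilon_1}\cdots\pi(n)^{\epsilon_n}]$. Set $\pi(0)=0$ and $\epsilon_0=0$. On colored letters $a^c$ ($a\in\{0,\dots,n\}$, $c\in[0,r-1]$, with $0$ only appearing as $0^0$) the Biagioli–Zeng order is: $a^c<b^d$ iff either ($c=d=0$ and $a<b$), or ($c,d>0$ and $a>b$), or ($c>0$ and $d=0$) (so all letters of positive color lie below $0^0$, which lies below $1^0<2^0<\cdots$). The descent set is $\operatorname{Des}(\epsilon,\pi)=\{i\in[0,n-1]\mid \pi(i)^{\epsilon_i}>\pi(i+1)^{\epsilon_{i+1}}\}$, $\operatorname{des}=|\operatorname{Des}|$, $\operatorname{maj}(\epsilon,\pi)=\sum_{i\in\operatorname{Des}(\epsilon,\pi)}i$, and $\operatorname{col}(\epsilon)=\operatorname{col}(\epsilon,\pi)=\sum_{i=1}^n\epsilon_i$. For integers $k\ge 0$ and $0\le j\le kr$ define $m'(j,k)=q^j$ if $0\le j\le k$, and $m'(j,k)=q^{(j-1)\bmod k}\,u^{\lfloor (j-1)/k\rfloor}$ if $k<j\le kr$, where $(j-1)\bmod k\in[0,k-1]$. For $(v_1,\dots,v_n,k)\in\mathbb{Z}^{n+1}$ with $k\ge0$ and $0\le v_i\le kr$, set $m(v,k)=\big(\prod_{i=1}^n m'(v_i,k)\big)t^k$, a monomial in variables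 $q,t,u$. For $\epsilon\in\mathbb{Z}_r^n$, let $F_\epsilon=(\epsilon+[0,1]^n)\setminus\bigcup_{i\in\operatorname{supp}(\epsilon)}\{x\in\mathbb{R}^n\mid x_i=\epsilon_i\}$, and let $L_\epsilon$ denote the set of lattice points of the cone over $F_\epsilon$, namely $L_\epsilon=\{(v,k)\in\mathbb{Z}^n\times\mathbb{Z}_{\ge0}\mid k\epsilon_i\le v_i\le k(\epsilon_i+1)\text{ for all }i,\text{ with }k\epsilon_i<v_i\text{ whenever }\epsilon_i>0\}$. -}

module Defs where

open import Data.Bool using (Bool; true; false; if_then_else_; _∧_; _∨_; not)
open import Data.Nat using (ℕ; zero; suc; _+_; _*_; _∸_; _<ᵇ_; _≤ᵇ_; _≡ᵇ_)
open import Data.Nat.DivMod using (_/_; _%_)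
open import Data.Integer using (ℤ; +_) renaming (_+_ to _+ℤ_)
import Data.Integer.Properties as ℤP
open import Data.Fin using (Fin; toℕ; inject₁) renaming (zero to fzero; suc to fsuc)
open import Data.Fin.Subset using (Subset)
open import Data.Fin.Permutation using (Permutation′; _⟨$⟩ʳ_)
open import Data.Vec using (Vec; []; _∷_; lookup; tabulate) renaming (map to vmap; sum to vsum)
open import Data.List using (List; []; _∷_; [_]; concatMap; upTo; length; filterᵇ) renaming (map to lmap)
open import Data.Product using (_×_; _,_; proj₁; proj₂)
open import Relation.Nullary.Decidable using (⌊_⌋)

Colouring : ℕ → ℕ → Set
Colouring r n = Vec (Fin r) n

-- A coloured letter a^c is a pair (a , c).
Letter : Set
Letter = ℕ × ℕ

_<BZ_ : Letter → Letter → Bool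
(a , zero)  <BZ (b , zero)  = a <ᵇ b
(a , suc _) <BZ (b , suc _) = b <ᵇ a
(a , suc _) <BZ (b , zero)  = true
(a , zero)  <BZ (b , suc _) = false

-- The letter π(i)^{ε_i} at position i ∈ [0,n]; position 0 carries 0^0,
-- position j+1 (window index, 1-based) carries π(j+1)^{ε_{j+1}}.
letterAt : ∀ {r n} → Colouring r n → Permutation′ n → Fin (suc n) → Letter
letterAt ε π fzero     = (0 , 0)
letterAt ε π (fsuc j)  = (suc (toℕ (π ⟨$⟩ʳ j)) , toℕ (lookup ε j))

-- Des(ε,π) ⊆ [0,n-1], as a subset of Fin n (element i ↔ position i).
Des : ∀ {r n} → Colouring r n → Permutation′ n → Subset n
Des ε π = tabulate λ i → letterAt ε π (fsuc i) <BZ letterAt ε π (inject₁ i)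

des : ∀ {r n} → Colouring r n → Permutation′ n → ℕ
des ε π = Data.Fin.Subset.∣ Des ε π ∣

maj : ∀ {r n} → Colouring r n → Permutation′ n → ℕ
maj {n = n} ε π = vsum (tabulate λ (i : Fin n) → if lookup (Des ε π) i then toℕ i else 0)

col : ∀ {r n} → Colouring r n → ℕ
col ε = vsum (vmap toℕ ε)

supp : ∀ {r n} → Colouring r n → Subset n
supp ε = tabulate λ i → not (toℕ (lookup ε i) ≡ᵇ 0)

-- Exponents (of q, of u) of the monomial m'(j,k).
m′ : ℕ → ℕ → ℕ × ℕ
m′ j zero    = (j , 0)
m′ j (suc k) = if j ≤ᵇ suc k then (j , 0)
               else (((j ∸ 1) % suc k) , ((j ∸ 1) / suc k))

-- Exponents (of q, of u) of ∏_i m'(v_i,k)  (the t-exponent of m(v,k) is k).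
mExp : ∀ {n} → Vec ℕ n → ℕ → ℕ × ℕ
mExp []       k = (0 , 0)
mExp (x ∷ xs) k = (proj₁ (m′ x k) + proj₁ (mExp xs k)) , (proj₂ (m′ x k) + proj₂ (mExp xs k))

-- Membership (v,k) ∈ L_ε, for v ∈ ℕ^n (any (v,k) ∈ L_ε has v_i ≥ kε_i ≥ 0).
inL : ∀ {r n} → Colouring r n → Vec ℕ n → ℕ → Bool
inL []       []       k = true
inL (e ∷ ε)  (v ∷ vs) k =
  (k * toℕ e ≤ᵇ v) ∧ (v ≤ᵇ k * (toℕ e + 1))
  ∧ (if toℕ e ≡ᵇ 0 then true else (k * toℕ e <ᵇ v))
  ∧ inL ε vs k

box : ℕ → (n : ℕ) → List (Vec ℕ n)
box N zero    = [ [] ]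
box N (suc n) = concatMap (λ x → lmap (x ∷_) (box N n)) (upTo (suc N))

-- Coefficient of q^a t^k u^b in Σ_{(v,k) ∈ L_ε} m(v,k).
-- For fixed k every (v,k) ∈ L_ε has 0 ≤ v_i ≤ k r, so the box [0,kr]^n suffices.
coeffL : ∀ {r n} → Colouring r n → ℕ → ℕ → ℤ → ℕ
coeffL {r} {n} ε a k b =
  length (filterᵇ (λ v → inL ε v k
                          ∧ (proj₁ (mExp v k) ≡ᵇ a)
                          ∧ ⌊ (+ proj₂ (mExp v k)) ℤP.≟ b ⌋)
                  (box (k * r) n))

module Submission where

-- The Biagioli–Zeng comparison of two coloured letters sees only
-- their values and whether each colour is zero or positive.  Colourings with
-- the same support therefore make the same comparison at every position, so
-- they have the same descent set, and des and maj are functions of it.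
--
-- A point (v,k) of L_ε is a choice,
-- independently for each coordinate i, of v_i in a "slab": [0,k] when
-- ε_i = 0 and ]kε_i, k(ε_i+1)] when ε_i > 0.  On the first slab
-- m'(v_i,k) = q^{v_i}; on the second, writing v_i = kε_i + 1 + t with t < k,
-- m'(v_i,k) = q^t u^{ε_i}.  Counting the box [0,kr]^n coordinate by
-- coordinate (count-box, slab-sum), the number of points of L_ε at level k
-- whose monomial satisfies a predicate R is an iterated sum over slab
-- parameters (levelSum) that depends on ε only through supp ε, applied to
-- R at u-exponent col ε (count-level).  Two colourings with equal support
-- thus have the same coefficients after shifting the u-exponent by
-- col ε − col ε′ (≟-translate).

open import Defs
open import Data.Bool using (Bool; true; false; if_then_else_; _∧_; not)
open import Data.Bool.Properties using (∧-assoc; ∧-zeroʳ; ∧-identityʳ; not-injective)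
open import Data.Nat
open import Data.Nat.Properties
open import Data.Nat.DivMod
open import Data.Nat.Divisibility using (divides)
open import Data.Fin using (Fin; toℕ; inject₁) renaming (zero to fzero; suc to fsuc)
open import Data.Fin.Properties using (toℕ<n)
open import Data.Fin.Subset using (Subset; ∣_∣)
open import Data.Fin.Permutation using (Permutation′)
open import Data.Vec using (Vec; []; _∷_; lookup; tabulate) renaming (sum to vsum)
open import Data.Vec.Properties using (lookup∘tabulate; tabulate-cong)
open import Data.List using (List; []; _∷_; _++_; applyUpTo; concatMap; length; filterᵇ) renaming (map to lmap)
open import Data.Product using (_×_; _,_; proj₁; proj₂)
open import Data.Integer using (ℤ; +_; _-_) renaming (_+_ to _+ℤ_)
import Data.Integer.Properties as ℤ
open import Data.Integer.Solver using (module +-*-Solver)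
open import Function using (_∘_)
open import Function.Bundles using (mk⇔)
open import Relation.Nullary.Decidable using (⌊_⌋; does; isYes≗does; dec-true; dec-false; does-⇔)
open import Relation.Binary.PropositionalEquality

_≈ˢ_ : Letter → Letter → Set
x ≈ˢ x′ = proj₁ x ≡ proj₁ x′ × (proj₂ x ≡ᵇ 0) ≡ (proj₂ x′ ≡ᵇ 0)

<BZ-respects-≈ˢ : ∀ {x x′ y y′} → x ≈ˢ x′ → y ≈ˢ y′ → x <BZ y ≡ x′ <BZ y′
<BZ-respects-≈ˢ {_ , zero}  {_ , zero}  {_ , zero}  {_ , zero}  (refl , _) (refl , _) = refl
<BZ-respects-≈ˢ {_ , zero}  {_ , zero}  {_ , suc _} {_ , suc _} (refl , _) (refl , _) = refl
<BZ-respects-≈ˢ {_ , suc _} {_ , suc _} {_ , zero}  {_ , zero}  (refl , _) (refl , _) = refl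
<BZ-respects-≈ˢ {_ , suc _} {_ , suc _} {_ , suc _} {_ , suc _} (refl , _) (refl , _) = refl
<BZ-respects-≈ˢ {_ , zero}  {_ , suc _} (_ , ()) _
<BZ-respects-≈ˢ {_ , suc _} {_ , zero}  (_ , ()) _
<BZ-respects-≈ˢ {y = _ , zero}  {_ , suc _} _ (_ , ())
<BZ-respects-≈ˢ {y = _ , suc _} {_ , zero}  _ (_ , ())

supp-zero-pattern : ∀ {r n} (ε ε′ : Colouring r n) → supp ε ≡ supp ε′ →
  ∀ j → (toℕ (lookup ε j) ≡ᵇ 0) ≡ (toℕ (lookup ε′ j) ≡ᵇ 0)
supp-zero-pattern ε ε′ eq j = not-injective (begin
  not (toℕ (lookup ε j) ≡ᵇ 0)   ≡⟨ lookup∘tabulate _ j ⟨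
  lookup (supp ε) j             ≡⟨ cong (λ s → lookup s j) eq ⟩
  lookup (supp ε′) j            ≡⟨ lookup∘tabulate _ j ⟩
  not (toℕ (lookup ε′ j) ≡ᵇ 0)  ∎)
  where open ≡-Reasoning

letterAt-≈ˢ : ∀ {r n} (ε ε′ : Colouring r n) → supp ε ≡ supp ε′ →
  (π : Permutation′ n) (i : Fin (suc n)) → letterAt ε π i ≈ˢ letterAt ε′ π i
letterAt-≈ˢ ε ε′ eq π fzero    = refl , refl
letterAt-≈ˢ ε ε′ eq π (fsuc j) = refl , supp-zero-pattern ε ε′ eq j

Des-supp : ∀ {r n} (ε ε′ : Colouring r n) → supp ε ≡ supp ε′ →
  (π : Permutation′ n) → Des ε′ π ≡ Des ε π
Des-supp ε ε′ eq π =
  tabulate-cong λ i →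
    <BZ-respects-≈ˢ {letter ε′ (fsuc i)} {letter ε (fsuc i)} {letter ε′ (inject₁ i)} {letter ε (inject₁ i)}
                    (letters (fsuc i)) (letters (inject₁ i))
  where
  letter : Colouring _ _ → Fin _ → Letter
  letter ε = letterAt ε π
  letters : ∀ i → letterAt ε′ π i ≈ˢ letterAt ε π i
  letters = letterAt-≈ˢ ε′ ε (sym eq) π

majOf : ∀ {n} → Subset n → ℕ
majOf {n} D = vsum (tabulate λ (i : Fin n) → if lookup D i then toℕ i else 0)

indicator : Bool → ℕ
indicator true  = 1
indicator false = 0

count : ∀ {A : Set} → (A → Bool) → List A → ℕ
count p []       = 0
count p (x ∷ xs) = indicator (p x) + count p xs

length-filterᵇ : ∀ {A : Set} (p : A → Bool) xs → length (filterᵇ p xs) ≡ count p xs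
length-filterᵇ p [] = refl
length-filterᵇ p (x ∷ xs) with p x
... | true  = cong suc (length-filterᵇ p xs)
... | false = length-filterᵇ p xs

count-++ : ∀ {A : Set} (p : A → Bool) xs ys → count p (xs ++ ys) ≡ count p xs + count p ys
count-++ p []       ys = refl
count-++ p (x ∷ xs) ys = trans (cong (_+_ (indicator (p x))) (count-++ p xs ys)) (sym (+-assoc (indicator (p x)) _ _))

count-map : ∀ {A C : Set} (p : A → Bool) (f : C → A) xs → count p (lmap f xs) ≡ count (p ∘ f) xs
count-map p f []       = refl
count-map p f (x ∷ xs) = cong (_+_ (indicator (p (f x)))) (count-map p f xs)

count-cong : ∀ {A : Set} {p p′ : A → Bool} → (∀ x → p x ≡ p′ x) → ∀ xs → count p xs ≡ count p′ xs
count-cong eq []       = refl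
count-cong eq (x ∷ xs) = cong₂ _+_ (cong indicator (eq x)) (count-cong eq xs)

count-guard : ∀ {A : Set} b (p : A → Bool) xs → count (λ x → b ∧ p x) xs ≡ (if b then count p xs else 0)
count-guard true  p xs       = refl
count-guard false p []       = refl
count-guard false p (x ∷ xs) = count-guard false p xs

sumBelow : ℕ → (ℕ → ℕ) → ℕ
sumBelow zero    f = 0
sumBelow (suc m) f = f 0 + sumBelow m (f ∘ suc)

sumBelow-+ : ∀ a b f → sumBelow (a + b) f ≡ sumBelow a f + sumBelow b (λ x → f (a + x))
sumBelow-+ zero    b f = refl
sumBelow-+ (suc a) b f = trans (cong (_+_ (f 0)) (sumBelow-+ a b (f ∘ suc))) (sym (+-assoc (f 0) _ _))

sumBelow-cong : ∀ m {f g} → (∀ x → x < m → f x ≡ g x) → sumBelow m f ≡ sumBelow m g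
sumBelow-cong zero    eq = refl
sumBelow-cong (suc m) eq = cong₂ _+_ (eq 0 z<s) (sumBelow-cong m (λ x x<m → eq (suc x) (s<s x<m)))

sumBelow-zero : ∀ m f → (∀ x → x < m → f x ≡ 0) → sumBelow m f ≡ 0
sumBelow-zero zero    f eq = refl
sumBelow-zero (suc m) f eq = cong₂ _+_ (eq 0 z<s) (sumBelow-zero m (f ∘ suc) (λ x x<m → eq (suc x) (s<s x<m)))

sumBelow-window : ∀ lo len N f g → lo + len ≤ N →
  (∀ x → x < lo → f x ≡ 0) → (∀ y → f (lo + len + y) ≡ 0) →
  (∀ t → t < len → f (lo + t) ≡ g t) →
  sumBelow N f ≡ sumBelow len g
sumBelow-window lo len N f g fits below above inside = begin
  sumBelow N f
    ≡⟨ cong (λ m → sumBelow m f) (sym (m+[n∸m]≡n fits)) ⟩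
  sumBelow (lo + len + rest) f
    ≡⟨ sumBelow-+ (lo + len) rest f ⟩
  sumBelow (lo + len) f + sumBelow rest (λ y → f (lo + len + y))
    ≡⟨ cong₂ _+_ (sumBelow-+ lo len f) (sumBelow-zero rest _ (λ y _ → above y)) ⟩
  sumBelow lo f + sumBelow len (λ t → f (lo + t)) + 0
    ≡⟨ cong₂ (λ a b → a + b + 0) (sumBelow-zero lo f below) (sumBelow-cong len inside) ⟩
  0 + sumBelow len g + 0
    ≡⟨ +-identityʳ _ ⟩
  sumBelow len g ∎
  where
  open ≡-Reasoning
  rest : ℕ
  rest = N ∸ (lo + len)

count-box : ∀ N n (p : Vec ℕ (suc n) → Bool) →
  count p (box N (suc n)) ≡ sumBelow (suc N) (λ x → count (p ∘ (x ∷_)) (box N n))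
count-box N n p = count-rows (λ x → x) (suc N)
  where
  count-rows : ∀ f m →
    count p (concatMap (λ x → lmap (x ∷_) (box N n)) (applyUpTo f m))
      ≡ sumBelow m (λ i → count (p ∘ (f i ∷_)) (box N n))
  count-rows f zero    = refl
  count-rows f (suc m) =
    trans (count-++ p (lmap (f 0 ∷_) (box N n)) _)
          (cong₂ _+_ (count-map p (f 0 ∷_) (box N n)) (count-rows (f ∘ suc) m))

≤ᵇ-true : ∀ {m n} → m ≤ n → (m ≤ᵇ n) ≡ true
≤ᵇ-true {m} {n} = dec-true (m ≤? n)

≤ᵇ-false : ∀ {m n} → n < m → (m ≤ᵇ n) ≡ false
≤ᵇ-false {m} {n} n<m = dec-false (m ≤? n) (<⇒≱ n<m)

<ᵇ-true : ∀ {m n} → m < n → (m <ᵇ n) ≡ true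
<ᵇ-true {m} {n} = dec-true (m <? n)

<ᵇ-false : ∀ {m n} → n ≤ m → (m <ᵇ n) ≡ false
<ᵇ-false {m} {n} n≤m = dec-false (m <? n) (≤⇒≯ n≤m)

inSlab : ℕ → ℕ → ℕ → Bool
inSlab e k x = (k * e ≤ᵇ x) ∧ (x ≤ᵇ k * (e + 1)) ∧ (if e ≡ᵇ 0 then true else (k * e <ᵇ x))

inL-cons : ∀ {r n} (e : Fin r) (ε : Colouring r n) k x xs →
  inL (e ∷ ε) (x ∷ xs) k ≡ inSlab (toℕ e) k x ∧ inL ε xs k
inL-cons e ε k x xs = sym (trans (∧-assoc lower (upper ∧ strict) (inL ε xs k))
                                  (cong (lower ∧_) (∧-assoc upper strict (inL ε xs k))))
  where
  lower upper strict : Bool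
  lower  = k * toℕ e ≤ᵇ x
  upper  = x ≤ᵇ k * (toℕ e + 1)
  strict = if toℕ e ≡ᵇ 0 then true else (k * toℕ e <ᵇ x)

inSlab-zero : ∀ k x → inSlab 0 k x ≡ (x ≤ᵇ k)
inSlab-zero k x rewrite *-zeroʳ k | *-identityʳ k = ∧-identityʳ _

inSlab-suc : ∀ c k x → inSlab (suc c) k x ≡ (k * suc c ≤ᵇ x) ∧ (x ≤ᵇ k * suc c + k) ∧ (k * suc c <ᵇ x)
inSlab-suc c k x = cong (λ y → (k * suc c ≤ᵇ x) ∧ (x ≤ᵇ y) ∧ (k * suc c <ᵇ x)) top
  where
  top : k * (suc c + 1) ≡ k * suc c + k
  top = trans (cong (k *_) (+-comm (suc c) 1)) (trans (*-suc k (suc c)) (+-comm k _))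

inSlab-suc-below : ∀ c k x → x ≤ k * suc c → inSlab (suc c) k x ≡ false
inSlab-suc-below c k x x≤K rewrite inSlab-suc c k x | <ᵇ-false x≤K =
  trans (cong ((k * suc c ≤ᵇ x) ∧_) (∧-zeroʳ _)) (∧-zeroʳ _)

inSlab-suc-above : ∀ c k x → k * suc c + k < x → inSlab (suc c) k x ≡ false
inSlab-suc-above c k x K+k<x rewrite inSlab-suc c k x | ≤ᵇ-false K+k<x = ∧-zeroʳ _

inSlab-suc-inside : ∀ c k t → t < k → inSlab (suc c) k (suc (k * suc c) + t) ≡ true
inSlab-suc-inside c k t t<k
  rewrite inSlab-suc c k (suc (k * suc c) + t)
        | ≤ᵇ-true (≤-trans (n≤1+n (k * suc c)) (m≤m+n (suc (k * suc c)) t))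
        | ≤ᵇ-true (subst (_≤ k * suc c + k) (+-suc (k * suc c) t) (+-monoʳ-≤ (k * suc c) t<k))
        | <ᵇ-true (s≤s (m≤m+n (k * suc c) t)) = refl

m′-low : ∀ x k → x ≤ k → m′ x k ≡ (x , 0)
m′-low x zero    x≤k = refl
m′-low x (suc k) x≤k rewrite ≤ᵇ-true x≤k = refl

m′-high : ∀ k c t → t < k → m′ (suc (k * suc c) + t) k ≡ (t , suc c)
m′-high (suc k′) c t t<k
  rewrite ≤ᵇ-false {suc (suc k′ * suc c) + t} {suc k′}
            (s≤s (≤-trans (m≤m*n (suc k′) (suc c)) (m≤m+n (suc k′ * suc c) t))) =
  cong₂ _,_ remainder quotient
  where
  K : ℕ
  K = suc k′ * suc c
  shape : K + t ≡ t + suc c * suc k′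
  shape = trans (+-comm K t) (cong (_+_ t) (*-comm (suc k′) (suc c)))
  remainder : (K + t) % suc k′ ≡ t
  remainder = trans (cong (_% suc k′) shape) (trans ([m+kn]%n≡m%n t (suc c) (suc k′)) (m<n⇒m%n≡m t<k))
  quotient : (K + t) / suc k′ ≡ suc c
  quotient = trans (cong (_/ suc k′) shape) (trans (+-distrib-/-∣ʳ t (divides (suc c) refl))
               (cong₂ _+_ (m<n⇒m/n≡0 t<k) (m*n/n≡m (suc c) (suc k′))))

slabSize : Bool → ℕ → ℕ
slabSize false k = suc k
slabSize true  k = k

slabTerm : ℕ → ℕ → (ℕ × ℕ → ℕ) → ℕ → ℕ
slabTerm e k G x = if inSlab e k x then G (m′ x k) else 0

slabTerm-out : ∀ e k G x → inSlab e k x ≡ false → slabTerm e k G x ≡ 0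
slabTerm-out e k G x out rewrite out = refl

slabTerm-in : ∀ e k G x {p} → inSlab e k x ≡ true → m′ x k ≡ p → slabTerm e k G x ≡ G p
slabTerm-in e k G x inside m′≡p rewrite inside = cong G m′≡p

slab-sum : ∀ k r e → e < r → (G : ℕ × ℕ → ℕ) →
  sumBelow (suc (k * r)) (slabTerm e k G) ≡ sumBelow (slabSize (not (e ≡ᵇ 0)) k) (λ t → G (t , e))
slab-sum k (suc r) zero _ G =
  sumBelow-window 0 (suc k) (suc (k * suc r)) _ _ (s≤s (m≤m*n k (suc r))) (λ _ ()) above inside
  where
  above : ∀ y → slabTerm 0 k G (suc k + y) ≡ 0
  above y = slabTerm-out 0 k G (suc k + y) (trans (inSlab-zero k (suc k + y)) (≤ᵇ-false (s≤s (m≤m+n k y))))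
  inside : ∀ t → t < suc k → slabTerm 0 k G t ≡ G (t , 0)
  inside t (s≤s t≤k) = slabTerm-in 0 k G t (trans (inSlab-zero k t) (≤ᵇ-true t≤k)) (m′-low t k t≤k)
slab-sum k (suc r) (suc c) (s≤s c<r) G =
  sumBelow-window (suc K) k (suc (k * suc r)) _ _ (s≤s fits) below above inside
  where
  K : ℕ
  K = k * suc c
  fits : K + k ≤ k * suc r
  fits = subst (_≤ k * suc r) (trans (*-suc k (suc c)) (+-comm k K)) (*-monoʳ-≤ k (s≤s c<r))
  below : ∀ x → x < suc K → slabTerm (suc c) k G x ≡ 0
  below x (s≤s x≤K) = slabTerm-out (suc c) k G x (inSlab-suc-below c k x x≤K)
  above : ∀ y → slabTerm (suc c) k G (suc K + k + y) ≡ 0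
  above y = slabTerm-out (suc c) k G (suc K + k + y) (inSlab-suc-above c k _ (s≤s (m≤m+n (K + k) y)))
  inside : ∀ t → t < k → slabTerm (suc c) k G (suc K + t) ≡ G (t , suc c)
  inside t t<k = slabTerm-in (suc c) k G (suc K + t) (inSlab-suc-inside c k t t<k) (m′-high k c t t<k)

-- levelSum s k g = Σ g(t₁ + ⋯ + tₙ) over 0 ≤ tᵢ < slabSize sᵢ k: the
-- q-exponents of the level-k points, read off from the support s alone.
levelSum : ∀ {n} → Subset n → ℕ → (ℕ → ℕ) → ℕ
levelSum []      k g = g 0
levelSum (s ∷ ss) k g = sumBelow (slabSize s k) (λ t → levelSum ss k (λ q → g (t + q)))

levelSum-cong : ∀ {n} (s : Subset n) k {g h : ℕ → ℕ} → (∀ q → g q ≡ h q) → levelSum s k g ≡ levelSum s k h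
levelSum-cong []      k eq = eq 0
levelSum-cong (b ∷ s) k eq = sumBelow-cong (slabSize b k) (λ t _ → levelSum-cong s k (λ q → eq (t + q)))

atLevel : ∀ {r n} → Colouring r n → ℕ → (ℕ → ℕ → Bool) → Vec ℕ n → Bool
atLevel ε k R v = inL ε v k ∧ R (proj₁ (mExp v k)) (proj₂ (mExp v k))

shift : ℕ × ℕ → (ℕ → ℕ → Bool) → ℕ → ℕ → Bool
shift p R q u = R (proj₁ p + q) (proj₂ p + u)

atLevel-cons : ∀ {r n} (e : Fin r) (ε : Colouring r n) k R x xs →
  atLevel (e ∷ ε) k R (x ∷ xs) ≡ inSlab (toℕ e) k x ∧ atLevel ε k (shift (m′ x k) R) xs
atLevel-cons e ε k R x xs =
  trans (cong (_∧ _) (inL-cons e ε k x xs)) (∧-assoc (inSlab (toℕ e) k x) (inL ε xs k) _)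

count-level : ∀ {r n} (ε : Colouring r n) k R →
  count (atLevel ε k R) (box (k * r) n) ≡ levelSum (supp ε) k (λ q → indicator (R q (col ε)))
count-level [] k R = +-identityʳ _
count-level {r} {suc n} (e ∷ ε) k R = begin
  count (atLevel (e ∷ ε) k R) (box N (suc n))
    ≡⟨ count-box N n _ ⟩
  sumBelow (suc N) (λ x → count (atLevel (e ∷ ε) k R ∘ (x ∷_)) (box N n))
    ≡⟨ sumBelow-cong (suc N) (λ x _ → first-coordinate x) ⟩
  sumBelow (suc N) (slabTerm (toℕ e) k G)
    ≡⟨ slab-sum k r (toℕ e) (toℕ<n e) G ⟩
  sumBelow (slabSize (not (toℕ e ≡ᵇ 0)) k) (λ t → G (t , toℕ e))
    ≡⟨ sumBelow-cong (slabSize (not (toℕ e ≡ᵇ 0)) k) (λ t _ → count-level ε k (shift (t , toℕ e) R)) ⟩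
  levelSum (supp (e ∷ ε)) k (λ q → indicator (R q (col (e ∷ ε)))) ∎
  where
  open ≡-Reasoning
  N : ℕ
  N = k * r
  G : ℕ × ℕ → ℕ
  G p = count (atLevel ε k (shift p R)) (box N n)
  first-coordinate : ∀ x → count (atLevel (e ∷ ε) k R ∘ (x ∷_)) (box N n) ≡ slabTerm (toℕ e) k G x
  first-coordinate x =
    trans (count-cong (atLevel-cons e ε k R x) (box N n)) (count-guard (inSlab (toℕ e) k x) _ (box N n))

≟-translate : ∀ (x y b : ℤ) → ⌊ x ℤ.≟ b ⌋ ≡ ⌊ y ℤ.≟ b - (x - y) ⌋
≟-translate x y b = begin
  ⌊ x ℤ.≟ b ⌋             ≡⟨ isYes≗does (x ℤ.≟ b) ⟩
  does (x ℤ.≟ b)           ≡⟨ does-⇔ (mk⇔ to from) (x ℤ.≟ b) (y ℤ.≟ b - (x - y)) ⟩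
  does (y ℤ.≟ b - (x - y)) ≡⟨ isYes≗does (y ℤ.≟ b - (x - y)) ⟨
  ⌊ y ℤ.≟ b - (x - y) ⌋   ∎
  where
  open +-*-Solver
  open ≡-Reasoning
  to : x ≡ b → y ≡ b - (x - y)
  to refl = solve 2 (λ x y → y := x :- (x :- y)) refl x y
  from : y ≡ b - (x - y) → x ≡ b
  from eq = begin
    x                        ≡⟨ solve 2 (λ x y → x := y :+ (x :- y)) refl x y ⟩
    y +ℤ (x - y)             ≡⟨ cong (_+ℤ (x - y)) eq ⟩
    (b - (x - y)) +ℤ (x - y) ≡⟨ solve 2 (λ b d → (b :- d) :+ d := b) refl b (x - y) ⟩
    b                        ∎

exponentsAre : ℕ → ℤ → ℕ → ℕ → Bool
exponentsAre a b q u = (q ≡ᵇ a) ∧ ⌊ + u ℤ.≟ b ⌋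

mainTheorem1 : (r n : ℕ) → 1 ≤ r → 1 ≤ n → (ε ε′ : Colouring r n) →
    supp ε ≡ supp ε′ →
    ((π : Permutation′ n) →
       (Des ε′ π ≡ Des ε π) × (des ε′ π ≡ des ε π) × (maj ε′ π ≡ maj ε π))
    ×
    ((a k : ℕ) (b : ℤ) →
       coeffL ε a k b ≡ coeffL ε′ a k (b - ((+ col ε) - (+ col ε′))))
mainTheorem1 r n _ _ ε ε′ eq = descents , coefficients
  where
  open ≡-Reasoning
  descents : (π : Permutation′ n) →
    (Des ε′ π ≡ Des ε π) × (des ε′ π ≡ des ε π) × (maj ε′ π ≡ maj ε π)
  descents π = let sameDes = Des-supp ε ε′ eq π in sameDes , cong ∣_∣ sameDes , cong majOf sameDes

  coefficients : (a k : ℕ) (b : ℤ) → coeffL ε a k b ≡ coeffL ε′ a k (b - ((+ col ε) - (+ col ε′)))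
  coefficients a k b = begin
    coeffL ε a k b
      ≡⟨ length-filterᵇ _ (box (k * r) n) ⟩
    count (atLevel ε k (exponentsAre a b)) (box (k * r) n)
      ≡⟨ count-level ε k (exponentsAre a b) ⟩
    levelSum (supp ε) k (λ q → indicator (exponentsAre a b q (col ε)))
      ≡⟨ cong (λ s → levelSum s k _) eq ⟩
    levelSum (supp ε′) k (λ q → indicator (exponentsAre a b q (col ε)))
      ≡⟨ levelSum-cong (supp ε′) k (λ q → cong (λ d → indicator ((q ≡ᵇ a) ∧ d)) (≟-translate (+ col ε) (+ col ε′) b)) ⟩
    levelSum (supp ε′) k (λ q → indicator (exponentsAre a b′ q (col ε′)))
      ≡⟨ count-level ε′ k (exponentsAre a b′) ⟨
    count (atLevel ε′ k (exponentsAre a b′)) (box (k * r) n)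
      ≡⟨ length-filterᵇ _ (box (k * r) n) ⟨
    coeffL ε′ a k b′ ∎
    where
    b′ : ℤ
    b′ = b - ((+ col ε) - (+ col ε′))
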